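{- Let $p$ be a prime and let $k$, $c$, $d$ be integers with $1 \leq k \leq c \leq d < c+d \leq p$. For every integer $\ell \in [1, c+d+1-k]$ let \[D(\ell)=\sum_{j=1}^{d+1-k}\binom{d-j}{k-1}\binom{c+d-k}{j-1}\binom{p-c-d+2k-2}{p+k+j-d-1-\ell}.\] Then for every integer $\ell\in[1,c+d+1-k]$, \[D(\ell)=\sum_{j=0}^{k-1}(-1)^j\binom{d-1-j}{k-1-j}\binom{c+d-k}{j}\binom{p+k-2-j}{\ell+k-2-c-j}.\]
   Context: Binomial coefficients follow the convention: for an integer $n$ and an integer $m\ge 0$, $\binom{n}{m}=n(n-1)\cdots(n-m+1)/m!$, and $\binom{n}{m}=0$ for integers $m<0$. -}

module Defs where

open import Data.Nat as ℕ using (ℕ; zero; suc)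
open import Data.Nat.Combinatorics using (_C_)
open import Data.Integer using (ℤ; +_; -[1+_]; _+_; _-_; _*_; -_)
open import Data.List using (List; []; _∷_; map; upTo; foldr)

sign : ℕ → ℤ
sign zero = + 1
sign (suc m) = - sign m

binomℕ : ℕ → ℕ → ℤ
binomℕ n m = + (n C m)

-- generalized binomial coefficient (n choose m) for integer n, integer m:
--  m < 0 : 0
--  n ≥ 0 : usual n C m
--  n = -(a+1) < 0, m ≥ 0 : (-1)^m ((m + a) C m)  = n(n-1)...(n-m+1)/m!
binom : ℤ → ℤ → ℤ
binom n -[1+ _ ] = + 0
binom (+ n) (+ m) = + (n C m)
binom -[1+ a ] (+ m) = sign m * + ((m ℕ.+ a) C m)

sumFrom : ℕ → (ℤ → ℤ) → ℤ → ℤ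
sumFrom zero f a = + 0
sumFrom (suc len) f a = f a + sumFrom len f (a + + 1)

Σ[_⋯_] : ℤ → ℤ → (ℤ → ℤ) → ℤ
Σ[ a ⋯ b ] f with b - a
... | + n = sumFrom (suc n) f a
... | -[1+ _ ] = + 0

-- (-1)^j for an integer j ≥ 0 (only used with j ≥ 0; value at negative j is irrelevant)
signℤ : ℤ → ℤ
signℤ (+ m) = sign m
signℤ -[1+ _ ] = + 0

{-# OPTIONS --safe #-}
-- After the substitution n = c + d - k, x = d - 1, m = k - 1, N = p - c - d + 2k - 2, r = ℓ + k - 2 - c,
-- and the symmetry C(N, N - y) = C(N, y) on the left, the theorem is a truncation of the identity
--   Σ_{j ≤ n} (-1)^j C(n,j) C(x-j, m-j) C(N+n-j, r-j) = Σ_{i ≤ n} C(n,i) C(x-i, m) C(N, r-i),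
-- which holds for all integers x, m, N, r. It is proved by induction on n: Pascal's rule in n reduces
-- each side to two sums with n - 1, and after the induction hypothesis Pascal's rule in N and then in x
-- turns the reduction of the left side into that of the right side. The ranges of summation in the
-- theorem differ from 0..n only by vanishing terms: C(x-i, m) = 0 for x - m < i ≤ x, C(N, r-i) = 0
-- for i > x ≥ r, and C(x-j, m-j) = 0 for j > m.
module Submission where

open import Defs
open import Data.Nat using (ℕ)
open import Data.Nat.Primality using (Prime)
open import Data.Integer using (ℤ; +_; _+_; _-_; _*_; _≤_; _<_)
open import Relation.Binary.PropositionalEquality using (_≡_)

open import Data.Nat as ℕ using (zero; suc; s≤s; z≤n)
import Data.Nat.Properties as ℕ
open import Data.Nat.Combinatorics using (_C_; nCk+nC[k+1]≡[n+1]C[k+1]; nCn≡1; nCk≡nC[n∸k]; k>n⇒nCk≡0)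
open import Data.Integer using (-[1+_]; -_)
open import Data.Integer.Properties using (+-identityˡ; +-identityʳ; +-assoc; +-comm; *-zeroʳ; *-distribʳ-+; neg-distrib-+; i≤j⇒0≤j-i; m-n≡m⊖n; ⊖-≥)
open import Data.Integer.Tactic.RingSolver using (solve-∀)
open import Data.Product using (∃; _,_)
open import Relation.Nullary using (yes; no)
open import Relation.Binary.PropositionalEquality using (refl; sym; trans; cong; cong₂; module ≡-Reasoning)
open ≡-Reasoning

binom-pascal : ∀ n m → binom (+ 1 + n) m ≡ binom n m + binom n (m - + 1)
binom-pascal n -[1+ _ ] = refl
binom-pascal (+ n) (+ zero) = refl
binom-pascal (+ n) (+ suc m) =
  cong +_ (trans (sym (nCk+nC[k+1]≡[n+1]C[k+1] n m)) (ℕ.+-comm (n C m) _))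
binom-pascal -[1+ zero ] (+ zero) = refl
binom-pascal -[1+ zero ] (+ suc m)
  rewrite ℕ.+-identityʳ m | nCn≡1 m | nCn≡1 (suc m) = cancel (sign m)
  where
  cancel : ∀ s → + 0 ≡ - s * + 1 + s * + 1
  cancel = solve-∀
binom-pascal -[1+ suc a ] (+ zero) = refl
binom-pascal -[1+ suc a ] (+ suc m) = begin
  - sign m * + X                           ≡⟨ split (sign m) (+ X) (+ Y) ⟩
  - sign m * (+ X + + Y) + sign m * + Y    ≡⟨ cong₂ (λ s t → - sign m * + s + sign m * + (t C m)) X+Y≡ (sym (ℕ.+-suc m a)) ⟩
  - sign m * + ((suc m ℕ.+ suc a) C suc m) + sign m * + ((m ℕ.+ suc a) C m) ∎
  where
  X = (suc m ℕ.+ a) C suc m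
  Y = (suc m ℕ.+ a) C m
  split : ∀ s x y → - s * x ≡ - s * (x + y) + s * y
  split = solve-∀
  X+Y≡ : X ℕ.+ Y ≡ (suc m ℕ.+ suc a) C suc m
  X+Y≡ = trans (ℕ.+-comm X Y) (trans (nCk+nC[k+1]≡[n+1]C[k+1] (suc m ℕ.+ a) m)
                                     (cong (λ t → suc t C suc m) (sym (ℕ.+-suc m a))))

binom-over : ∀ {a b} → a ℕ.< b → binom (+ a) (+ b) ≡ + 0
binom-over a<b = cong +_ (k>n⇒nCk≡0 a<b)

binom-sym : ∀ N y → binom (+ N) (+ N - y) ≡ binom (+ N) y
binom-sym N -[1+ t ] = binom-over (ℕ.m<m+n N (s≤s z≤n))
binom-sym N (+ b) with b ℕ.≤? N
... | yes b≤N = trans (cong (binom (+ N)) (trans (m-n≡m⊖n N b) (⊖-≥ b≤N))) (cong +_ (sym (nCk≡nC[n∸k] b≤N)))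
... | no b≰N with ℕ.m≤n⇒∃[o]m+o≡n (ℕ.≰⇒> b≰N)
...   | t , refl = trans (cong (binom (+ N)) (N-[1+N+t] (+ N) (+ t))) (sym (binom-over (s≤s (ℕ.m≤m+n N t))))
  where
  N-[1+N+t] : ∀ n t → n - (+ 1 + n + t) ≡ - (+ 1 + t)
  N-[1+N+t] = solve-∀

∑ : ℕ → (ℕ → ℤ) → ℤ
∑ zero    f = + 0
∑ (suc n) f = f 0 + ∑ n (λ i → f (suc i))

∑-cong : ∀ n {f g : ℕ → ℤ} → (∀ i → f i ≡ g i) → ∑ n f ≡ ∑ n g
∑-cong zero    f≡g = refl
∑-cong (suc n) f≡g = cong₂ _+_ (f≡g 0) (∑-cong n (λ i → f≡g (suc i)))

∑-distrib-+ : ∀ n (f g : ℕ → ℤ) → ∑ n (λ i → f i + g i) ≡ ∑ n f + ∑ n g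
∑-distrib-+ zero    f g = refl
∑-distrib-+ (suc n) f g = trans (cong (_+_ (f 0 + g 0)) (∑-distrib-+ n _ _)) (interchange (f 0) (g 0) _ _)
  where
  interchange : ∀ (a b c d : ℤ) → (a + b) + (c + d) ≡ (a + c) + (b + d)
  interchange = solve-∀

∑-neg : ∀ n (f : ℕ → ℤ) → ∑ n (λ i → - f i) ≡ - ∑ n f
∑-neg zero    f = refl
∑-neg (suc n) f = trans (cong (_+_ (- f 0)) (∑-neg n _)) (sym (neg-distrib-+ (f 0) _))

∑-zero : ∀ n {f : ℕ → ℤ} → (∀ i → f i ≡ + 0) → ∑ n f ≡ + 0
∑-zero zero    f≡0 = refl
∑-zero (suc n) f≡0 = cong₂ _+_ (f≡0 0) (∑-zero n (λ i → f≡0 (suc i)))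

∑-init-last : ∀ n (f : ℕ → ℤ) → ∑ (suc n) f ≡ ∑ n f + f n
∑-init-last zero    f = trans (+-identityʳ (f 0)) (sym (+-identityˡ (f 0)))
∑-init-last (suc n) f = trans (cong (_+_ (f 0)) (∑-init-last n _)) (sym (+-assoc (f 0) _ _))

∑-++ : ∀ a b (f : ℕ → ℤ) → ∑ (a ℕ.+ b) f ≡ ∑ a f + ∑ b (λ i → f (a ℕ.+ i))
∑-++ zero    b f = sym (+-identityˡ _)
∑-++ (suc a) b f = trans (cong (_+_ (f 0)) (∑-++ a b _)) (sym (+-assoc (f 0) _ _))

∑-extend-by-zeros : ∀ a b (f : ℕ → ℤ) → (∀ i → f (a ℕ.+ i) ≡ + 0) → ∑ (a ℕ.+ b) f ≡ ∑ a f
∑-extend-by-zeros a b f zeros = begin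
  ∑ (a ℕ.+ b) f                       ≡⟨ ∑-++ a b f ⟩
  ∑ a f + ∑ b (λ i → f (a ℕ.+ i))     ≡⟨ cong (_+_ (∑ a f)) (∑-zero b zeros) ⟩
  ∑ a f + + 0                         ≡⟨ +-identityʳ _ ⟩
  ∑ a f                               ∎

sumFrom-as-∑ : ∀ n (f : ℤ → ℤ) a → sumFrom n f a ≡ ∑ n (λ i → f (a + + i))
sumFrom-as-∑ zero    f a = refl
sumFrom-as-∑ (suc n) f a = cong₂ _+_ (cong f (sym (+-identityʳ a)))
  (trans (sumFrom-as-∑ n f (a + + 1)) (∑-cong n (λ i → cong f (+-assoc a (+ 1) (+ i)))))

Σ-as-∑ : ∀ a b n (f : ℤ → ℤ) → b - a ≡ + n → Σ[ a ⋯ b ] f ≡ ∑ (suc n) (λ i → f (a + + i))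
Σ-as-∑ a b n f b-a≡n rewrite b-a≡n = sumFrom-as-∑ (suc n) f a

∑-binom-pascal : ∀ n (a : ℕ → ℤ) →
  ∑ (suc (suc n)) (λ j → binom (+ suc n) (+ j) * a j)
    ≡ ∑ (suc n) (λ j → binom (+ n) (+ j) * a j) + ∑ (suc n) (λ j → binom (+ n) (+ j) * a (suc j))
∑-binom-pascal n a = begin
  ∑ (suc (suc n)) (λ j → binom (+ suc n) (+ j) * a j)
    ≡⟨ ∑-cong (suc (suc n)) (λ j → trans (cong (λ b → b * a j) (binom-pascal (+ n) (+ j)))
                                         (*-distribʳ-+ (a j) (binom (+ n) (+ j)) (binom (+ n) (+ j - + 1)))) ⟩
  ∑ (suc (suc n)) (λ j → f j + g j)
    ≡⟨ ∑-distrib-+ (suc (suc n)) f g ⟩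
  ∑ (suc (suc n)) f + ∑ (suc (suc n)) g
    ≡⟨ cong₂ _+_ drop-last (+-identityˡ _) ⟩
      -- the j = 0 term of the second sum is binom (+ n) -[1+ 0 ] * a 0 = + 0
  ∑ (suc n) f + ∑ (suc n) (λ j → binom (+ n) (+ j) * a (suc j)) ∎
  where
  f g : ℕ → ℤ
  f j = binom (+ n) (+ j) * a j
  g j = binom (+ n) (+ j - + 1) * a j
  drop-last : ∑ (suc (suc n)) f ≡ ∑ (suc n) f
  drop-last = trans (∑-init-last (suc n) f)
    (trans (cong (λ b → ∑ (suc n) f + b * a (suc n)) (binom-over (ℕ.n<1+n n))) (+-identityʳ _))

x-[1+j]≡x-1-j : ∀ x j → x - (+ 1 + j) ≡ (x - + 1) - j
x-[1+j]≡x-1-j = solve-∀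

alternatingTerm : ℕ → ℤ → ℤ → ℤ → ℤ → ℕ → ℤ
alternatingTerm n x m N r j = binom (+ n) (+ j) * (sign j * binom (x - + j) (m - + j) * binom (N + + n - + j) (r - + j))

alternatingSum : ℕ → ℤ → ℤ → ℤ → ℤ → ℤ
alternatingSum n x m N r = ∑ (suc n) (alternatingTerm n x m N r)

positiveTerm : ℕ → ℤ → ℤ → ℤ → ℤ → ℕ → ℤ
positiveTerm n x m N r i = binom (+ n) (+ i) * (binom (x - + i) m * binom N (r - + i))

positiveSum : ℕ → ℤ → ℤ → ℤ → ℤ → ℤ
positiveSum n x m N r = ∑ (suc n) (positiveTerm n x m N r)

alternatingSum-suc : ∀ n x m N r →
  alternatingSum (suc n) x m N r ≡ alternatingSum n x m (N + + 1) r - alternatingSum n (x - + 1) (m - + 1) N (r - + 1)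
alternatingSum-suc n x m N r =
  trans (∑-binom-pascal n (λ j → sign j * binom (x - + j) (m - + j) * binom (N + + suc n - + j) (r - + j)))
        (cong₂ _+_ (∑-cong (suc n) unshifted) (trans (∑-cong (suc n) shifted) (∑-neg (suc n) (alternatingTerm n (x - + 1) (m - + 1) N (r - + 1)))))
  where
  N+[1+n]-j≡[N+1]+n-j : ∀ N n j → N + (+ 1 + n) - j ≡ (N + + 1) + n - j
  N+[1+n]-j≡[N+1]+n-j = solve-∀
  N+[1+n]-[1+j]≡N+n-j : ∀ N n j → N + (+ 1 + n) - (+ 1 + j) ≡ N + n - j
  N+[1+n]-[1+j]≡N+n-j = solve-∀
  negate-middle : ∀ c s b₁ b₂ → c * (- s * b₁ * b₂) ≡ - (c * (s * b₁ * b₂))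
  negate-middle = solve-∀
  unshifted : ∀ j → binom (+ n) (+ j) * (sign j * binom (x - + j) (m - + j) * binom (N + + suc n - + j) (r - + j))
                    ≡ alternatingTerm n x m (N + + 1) r j
  unshifted j = cong (λ t → binom (+ n) (+ j) * (sign j * binom (x - + j) (m - + j) * binom t (r - + j)))
                     (N+[1+n]-j≡[N+1]+n-j N (+ n) (+ j))
  shifted : ∀ j → binom (+ n) (+ j) * (sign (suc j) * binom (x - + suc j) (m - + suc j) * binom (N + + suc n - + suc j) (r - + suc j))
                  ≡ - alternatingTerm n (x - + 1) (m - + 1) N (r - + 1) j
  shifted j = trans
    (cong₂ (λ t u → binom (+ n) (+ j) * (- sign j * t * u))
           (cong₂ binom (x-[1+j]≡x-1-j x (+ j)) (x-[1+j]≡x-1-j m (+ j)))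
           (cong₂ binom (N+[1+n]-[1+j]≡N+n-j N (+ n) (+ j)) (x-[1+j]≡x-1-j r (+ j))))
    (negate-middle (binom (+ n) (+ j)) (sign j) (binom ((x - + 1) - + j) ((m - + 1) - + j)) (binom (N + + n - + j) ((r - + 1) - + j)))

positiveSum-suc : ∀ n x m N r →
  positiveSum (suc n) x m N r ≡ positiveSum n x m N r + positiveSum n (x - + 1) m N (r - + 1)
positiveSum-suc n x m N r =
  trans (∑-binom-pascal n (λ i → binom (x - + i) m * binom N (r - + i)))
        (cong (_+_ (positiveSum n x m N r)) (∑-cong (suc n) shifted))
  where
  shifted : ∀ i → binom (+ n) (+ i) * (binom (x - + suc i) m * binom N (r - + suc i))
                  ≡ positiveTerm n (x - + 1) m N (r - + 1) i
  shifted i = cong₂ (λ t u → binom (+ n) (+ i) * (binom t m * binom N u))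
                    (x-[1+j]≡x-1-j x (+ i)) (x-[1+j]≡x-1-j r (+ i))

positiveSum-pascal-N : ∀ n x m N r →
  positiveSum n x m (N + + 1) r ≡ positiveSum n x m N r + positiveSum n x m N (r - + 1)
positiveSum-pascal-N n x m N r =
  trans (∑-cong (suc n) split) (∑-distrib-+ (suc n) (positiveTerm n x m N r) (positiveTerm n x m N (r - + 1)))
  where
  r-j-1≡r-1-j : ∀ r j → (r - j) - + 1 ≡ (r - + 1) - j
  r-j-1≡r-1-j = solve-∀
  distrib : ∀ a b c d → a * (b * (c + d)) ≡ a * (b * c) + a * (b * d)
  distrib = solve-∀
  split : ∀ i → positiveTerm n x m (N + + 1) r i ≡ positiveTerm n x m N r i + positiveTerm n x m N (r - + 1) i
  split i = trans
    (cong (λ t → binom (+ n) (+ i) * (binom (x - + i) m * t))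
          (begin
            binom (N + + 1) (r - + i)                         ≡⟨ cong (λ M → binom M (r - + i)) (+-comm N (+ 1)) ⟩
            binom (+ 1 + N) (r - + i)                         ≡⟨ binom-pascal N (r - + i) ⟩
            binom N (r - + i) + binom N ((r - + i) - + 1)     ≡⟨ cong (λ u → binom N (r - + i) + binom N u) (r-j-1≡r-1-j r (+ i)) ⟩
            binom N (r - + i) + binom N ((r - + 1) - + i)     ∎))
    (distrib (binom (+ n) (+ i)) (binom (x - + i) m) (binom N (r - + i)) (binom N ((r - + 1) - + i)))

positiveSum-pascal-x : ∀ n x m N r →
  positiveSum n x m N r ≡ positiveSum n (x - + 1) m N r + positiveSum n (x - + 1) (m - + 1) N r
positiveSum-pascal-x n x m N r =
  trans (∑-cong (suc n) split) (∑-distrib-+ (suc n) (positiveTerm n (x - + 1) m N r) (positiveTerm n (x - + 1) (m - + 1) N r))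
  where
  x-j≡1+[x-1-j] : ∀ x j → x - j ≡ + 1 + ((x - + 1) - j)
  x-j≡1+[x-1-j] = solve-∀
  distrib : ∀ a b c d → a * ((c + d) * b) ≡ a * (c * b) + a * (d * b)
  distrib = solve-∀
  split : ∀ i → positiveTerm n x m N r i ≡ positiveTerm n (x - + 1) m N r i + positiveTerm n (x - + 1) (m - + 1) N r i
  split i = trans
    (cong (λ t → binom (+ n) (+ i) * (t * binom N (r - + i)))
          (trans (cong (λ y → binom y m) (x-j≡1+[x-1-j] x (+ i))) (binom-pascal ((x - + 1) - + i) m)))
    (distrib (binom (+ n) (+ i)) (binom N (r - + i)) (binom ((x - + 1) - + i) m) (binom ((x - + 1) - + i) (m - + 1)))

alternatingSum≡positiveSum : ∀ n x m N r → alternatingSum n x m N r ≡ positiveSum n x m N r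
alternatingSum≡positiveSum zero x m N r =
  trans (cong₂ (λ t u → + 1 * (+ 1 * binom (x - + 0) t * binom u (r - + 0)) + + 0) (+-identityʳ m) (trans (+-identityʳ _) (+-identityʳ N)))
        (drop-units (binom (x - + 0) m) (binom N (r - + 0)))
  where
  drop-units : ∀ a b → + 1 * (+ 1 * a * b) + + 0 ≡ + 1 * (a * b) + + 0
  drop-units = solve-∀
alternatingSum≡positiveSum (suc n) x m N r = begin
  alternatingSum (suc n) x m N r
    ≡⟨ alternatingSum-suc n x m N r ⟩
  alternatingSum n x m (N + + 1) r - alternatingSum n (x - + 1) (m - + 1) N (r - + 1)
    ≡⟨ cong₂ _-_ (alternatingSum≡positiveSum n x m (N + + 1) r) (alternatingSum≡positiveSum n (x - + 1) (m - + 1) N (r - + 1)) ⟩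
  positiveSum n x m (N + + 1) r - C
    ≡⟨ cong (_- C) (positiveSum-pascal-N n x m N r) ⟩
  (A + positiveSum n x m N (r - + 1)) - C
    ≡⟨ cong (λ t → (A + t) - C) (positiveSum-pascal-x n x m N (r - + 1)) ⟩
  (A + (B + C)) - C
    ≡⟨ cancel A B C ⟩
  A + B
    ≡⟨ positiveSum-suc n x m N r ⟨
  positiveSum (suc n) x m N r ∎
  where
  A = positiveSum n x m N r
  B = positiveSum n (x - + 1) m N (r - + 1)
  C = positiveSum n (x - + 1) (m - + 1) N (r - + 1)
  cancel : ∀ a b c → (a + (b + c)) - c ≡ a + b
  cancel = solve-∀

positiveTerm-vanishes-below : ∀ n s t i N r →
  positiveTerm n (+ (suc i ℕ.+ t ℕ.+ s)) (+ (suc i ℕ.+ t)) N r (suc s ℕ.+ i) ≡ + 0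
positiveTerm-vanishes-below n s t i N r =
  trans (cong (λ b → binom (+ n) (+ j) * (b * binom N (r - + j)))
              (trans (cong (λ y → binom y (+ (suc i ℕ.+ t))) (x-j≡t (+ i) (+ t) (+ s))) (binom-over (s≤s (ℕ.m≤n+m t i)))))
        (*-zeroʳ (binom (+ n) (+ j)))
  where
  j = suc s ℕ.+ i
  x-j≡t : ∀ i t s → (+ 1 + i + t + s) - (+ 1 + s + i) ≡ t
  x-j≡t = solve-∀

positiveTerm-vanishes-above : ∀ n M s w N r t → r + + w ≡ + (M ℕ.+ s) →
  positiveTerm n (+ (M ℕ.+ s)) (+ M) N r (suc s ℕ.+ (M ℕ.+ t)) ≡ + 0
positiveTerm-vanishes-above n M s w N r t r+w≡M+s =
  trans (cong (λ y → binom (+ n) (+ j) * (binom (+ (M ℕ.+ s) - + j) (+ M) * binom N y)) r-j≡-[1+w+t])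
        (zero-factor (binom (+ n) (+ j)) (binom (+ (M ℕ.+ s) - + j) (+ M)))
  where
  j = suc s ℕ.+ (M ℕ.+ t)
  shift : ∀ r w M s t → r - (+ 1 + s + (M + t)) ≡ ((r + w) - (M + s)) - (+ 1 + (w + t))
  shift = solve-∀
  cancel : ∀ x y → (x - x) - y ≡ - y
  cancel = solve-∀
  zero-factor : ∀ c b → c * (b * + 0) ≡ + 0
  zero-factor = solve-∀
  r-j≡-[1+w+t] : r - + j ≡ - (+ 1 + (+ w + + t))
  r-j≡-[1+w+t] = begin
    r - + j                                             ≡⟨ shift r (+ w) (+ M) (+ s) (+ t) ⟩
    ((r + + w) - + (M ℕ.+ s)) - (+ 1 + (+ w + + t))     ≡⟨ cong (λ y → (y - + (M ℕ.+ s)) - (+ 1 + (+ w + + t))) r+w≡M+s ⟩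
    (+ (M ℕ.+ s) - + (M ℕ.+ s)) - (+ 1 + (+ w + + t))   ≡⟨ cancel (+ (M ℕ.+ s)) (+ 1 + (+ w + + t)) ⟩
    - (+ 1 + (+ w + + t))                               ∎

positiveTerm-vanishes : ∀ n M s w N r i → r + + w ≡ + (M ℕ.+ s) →
  positiveTerm n (+ (M ℕ.+ s)) (+ M) N r (suc s ℕ.+ i) ≡ + 0
positiveTerm-vanishes n M s w N r i r+w≡M+s with i ℕ.<? M
... | yes i<M with ℕ.m≤n⇒∃[o]m+o≡n i<M
...   | t , refl = positiveTerm-vanishes-below n s t i N r
positiveTerm-vanishes n M s w N r i r+w≡M+s | no i≮M with ℕ.m≤n⇒∃[o]m+o≡n (ℕ.≮⇒≥ i≮M)
...   | t , refl = positiveTerm-vanishes-above n M s w N r t r+w≡M+s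

alternatingTerm-vanishes : ∀ n x M N r i → alternatingTerm n x (+ M) N r (suc M ℕ.+ i) ≡ + 0
alternatingTerm-vanishes n x M N r i =
  trans (cong (λ y → binom (+ n) (+ j) * (sign j * binom (x - + j) y * binom (N + + n - + j) (r - + j))) (M-[1+M+i] (+ M) (+ i)))
        (zero-factor (binom (+ n) (+ j)) (sign j) (binom (N + + n - + j) (r - + j)))
  where
  j = suc M ℕ.+ i
  M-[1+M+i] : ∀ M i → M - (+ 1 + M + i) ≡ - (+ 1 + i)
  M-[1+M+i] = solve-∀
  zero-factor : ∀ c s b → c * (s * + 0 * b) ≡ + 0
  zero-factor = solve-∀

truncated-identity : ∀ M s e N r w → r + + w ≡ + (M ℕ.+ s) →
  ∑ (suc s) (positiveTerm (M ℕ.+ (s ℕ.+ e)) (+ (M ℕ.+ s)) (+ M) N r)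
    ≡ ∑ (suc M) (alternatingTerm (M ℕ.+ (s ℕ.+ e)) (+ (M ℕ.+ s)) (+ M) N r)
truncated-identity M s e N r w r+w≡M+s = begin
  ∑ (suc s) (positiveTerm n x m N r)
    ≡⟨ ∑-extend-by-zeros (suc s) (M ℕ.+ e) (positiveTerm n x m N r) (λ i → positiveTerm-vanishes n M s w N r i r+w≡M+s) ⟨
  ∑ (suc (s ℕ.+ (M ℕ.+ e))) (positiveTerm n x m N r)
    ≡⟨ cong (λ l → ∑ (suc l) (positiveTerm n x m N r)) s+[M+e]≡M+[s+e] ⟩
  positiveSum n x m N r
    ≡⟨ alternatingSum≡positiveSum n x m N r ⟨
  alternatingSum n x m N r
    ≡⟨ ∑-extend-by-zeros (suc M) (s ℕ.+ e) (alternatingTerm n x m N r) (alternatingTerm-vanishes n x M N r) ⟩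
  ∑ (suc M) (alternatingTerm n x m N r) ∎
  where
  n = M ℕ.+ (s ℕ.+ e)
  x = + (M ℕ.+ s)
  m = + M
  s+[M+e]≡M+[s+e] : s ℕ.+ (M ℕ.+ e) ≡ M ℕ.+ (s ℕ.+ e)
  s+[M+e]≡M+[s+e] = trans (sym (ℕ.+-assoc s M e)) (trans (cong (ℕ._+ e) (ℕ.+-comm s M)) (ℕ.+-assoc M s e))

i≤j⇒∃[w]i+w≡j : ∀ {i j : ℤ} → i ≤ j → ∃ λ w → i + + w ≡ j
i≤j⇒∃[w]i+w≡j {i} {j} i≤j with j - i in j-i≡w | i≤j⇒0≤j-i i≤j
... | + w | _ = w , trans (cong (_+_ i) (sym j-i≡w)) (i+[j-i]≡j i j)
  where
  i+[j-i]≡j : ∀ i j → i + (j - i) ≡ j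
  i+[j-i]≡j = solve-∀

module Gaps (k' u v q : ℕ) (ℓ : ℤ) where
  k c d P r x : ℤ
  k = + 1 + + k'
  c = k + + u
  d = c + + v
  P = c + d + + q
  r = ℓ + k - + 2 - c
  x = + (k' ℕ.+ (u ℕ.+ v))

  n N : ℕ
  n = k' ℕ.+ ((u ℕ.+ v) ℕ.+ suc u)
  N = q ℕ.+ k' ℕ.+ k'

  lhs-term rhs-term : ℤ → ℤ
  lhs-term j = binom (d - j) (k - + 1) * binom (c + d - k) (j - + 1) * binom (P - c - d + + 2 * k - + 2) (P + k + j - d - + 1 - ℓ)
  rhs-term j = signℤ j * binom (d - + 1 - j) (k - + 1 - j) * binom (c + d - k) j * binom (P + k - + 2 - j) (ℓ + k - + 2 - c - j)

  c+d-k≡n : c + d - k ≡ + n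
  c+d-k≡n = ring (+ k') (+ u) (+ v)
    where
    ring : ∀ K U V → (+ 1 + K + U) + ((+ 1 + K + U) + V) - (+ 1 + K) ≡ K + ((U + V) + (+ 1 + U))
    ring = solve-∀

  lhs-term≡positiveTerm : ∀ i → lhs-term (+ 1 + + i) ≡ positiveTerm n x (+ k') (+ N) r i
  lhs-term≡positiveTerm i = trans
    (cong₂ _*_ (cong₂ _*_ (cong (λ y → binom y (+ k')) (d-[1+i]≡x-i (+ k') (+ u) (+ v) (+ i))) (cong (λ y → binom y (+ i)) c+d-k≡n))
               (trans (cong₂ binom (P-c-d+2k-2≡N (+ k') (+ u) (+ v) (+ q)) (bottom≡N-[r-i] (+ k') (+ u) (+ v) (+ q) ℓ (+ i)))
                      (binom-sym N (r - + i))))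
    (rearrange (binom (x - + i) (+ k')) (binom (+ n) (+ i)) (binom (+ N) (r - + i)))
    where
    d-[1+i]≡x-i : ∀ K U V I → ((+ 1 + K + U) + V) - (+ 1 + I) ≡ (K + (U + V)) - I
    d-[1+i]≡x-i = solve-∀
    P-c-d+2k-2≡N : ∀ K U V Q → let C = + 1 + K + U; D = C + V in
      (C + D + Q) - C - D + + 2 * (+ 1 + K) - + 2 ≡ Q + K + K
    P-c-d+2k-2≡N = solve-∀
    bottom≡N-[r-i] : ∀ K U V Q L I → let C = + 1 + K + U; D = C + V in
      (C + D + Q) + (+ 1 + K) + (+ 1 + I) - D - + 1 - L ≡ (Q + K + K) - ((L + (+ 1 + K) - + 2 - C) - I)
    bottom≡N-[r-i] = solve-∀
    rearrange : ∀ a b e → a * b * e ≡ b * (a * e)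
    rearrange = solve-∀

  rhs-term≡alternatingTerm : ∀ j → rhs-term (+ j) ≡ alternatingTerm n x (+ k') (+ N) r j
  rhs-term≡alternatingTerm j = trans
    (cong₂ _*_ (cong₂ _*_ (cong (λ y → sign j * binom (y - + j) (+ k' - + j)) (d-1≡x (+ k') (+ u) (+ v))) (cong (λ y → binom y (+ j)) c+d-k≡n))
               (cong (λ y → binom (y - + j) (r - + j)) (P+k-2≡N+n (+ k') (+ u) (+ v) (+ q))))
    (rearrange (sign j) (binom (x - + j) (+ k' - + j)) (binom (+ n) (+ j)) (binom (+ N + + n - + j) (r - + j)))
    where
    d-1≡x : ∀ K U V → ((+ 1 + K + U) + V) - + 1 ≡ K + (U + V)
    d-1≡x = solve-∀
    P+k-2≡N+n : ∀ K U V Q → let C = + 1 + K + U; D = C + V in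
      (C + D + Q) + (+ 1 + K) - + 2 ≡ (Q + K + K) + (K + ((U + V) + (+ 1 + U)))
    P+k-2≡N+n = solve-∀
    rearrange : ∀ s a b e → s * a * b * e ≡ b * (s * a * e)
    rearrange = solve-∀

  r+w≡x : ∀ w → ℓ + + w ≡ c + d + + 1 - k → r + + w ≡ x
  r+w≡x w ℓ+w≡c+d+1-k = begin
    r + + w                                  ≡⟨ regroup ℓ (+ w) k c ⟩
    (ℓ + + w) + (k - + 2 - c)                ≡⟨ cong (λ y → y + (k - + 2 - c)) ℓ+w≡c+d+1-k ⟩
    (c + d + + 1 - k) + (k - + 2 - c)        ≡⟨ simplify (+ k') (+ u) (+ v) ⟩
    x                                        ∎
    where
    regroup : ∀ L W K C → (L + K - + 2 - C) + W ≡ (L + W) + (K - + 2 - C)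
    regroup = solve-∀
    simplify : ∀ K U V → let C = + 1 + K + U; D = C + V in
      (C + D + + 1 - (+ 1 + K)) + ((+ 1 + K) - + 2 - C) ≡ K + (U + V)
    simplify = solve-∀

  lhs≡rhs : ∀ w → ℓ + + w ≡ c + d + + 1 - k → Σ[ + 1 ⋯ d + + 1 - k ] lhs-term ≡ Σ[ + 0 ⋯ k - + 1 ] rhs-term
  lhs≡rhs w ℓ+w≡c+d+1-k = begin
    Σ[ + 1 ⋯ d + + 1 - k ] lhs-term                       ≡⟨ Σ-as-∑ (+ 1) (d + + 1 - k) (u ℕ.+ v) lhs-term (length (+ k') (+ u) (+ v)) ⟩
    ∑ (suc (u ℕ.+ v)) (λ i → lhs-term (+ 1 + + i))         ≡⟨ ∑-cong (suc (u ℕ.+ v)) lhs-term≡positiveTerm ⟩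
    ∑ (suc (u ℕ.+ v)) (positiveTerm n x (+ k') (+ N) r)    ≡⟨ truncated-identity k' (u ℕ.+ v) (suc u) (+ N) r w (r+w≡x w ℓ+w≡c+d+1-k) ⟩
    ∑ (suc k') (alternatingTerm n x (+ k') (+ N) r)        ≡⟨ ∑-cong (suc k') rhs-term≡alternatingTerm ⟨
    ∑ (suc k') (λ j → rhs-term (+ 0 + + j))               ≡⟨ Σ-as-∑ (+ 0) (k - + 1) k' rhs-term (+-identityʳ (+ k')) ⟨
    Σ[ + 0 ⋯ k - + 1 ] rhs-term                           ∎
    where
    length : ∀ K U V → ((+ 1 + K + U) + V + + 1 - (+ 1 + K)) - + 1 ≡ U + V
    length = solve-∀

proposition5 : (p : ℕ) → Prime p → (k c d : ℤ) →
    + 1 ≤ k → k ≤ c → c ≤ d → d < c + d → c + d ≤ + p →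
    let P = + p
        D : ℤ → ℤ
        D ℓ = Σ[ + 1 ⋯ d + + 1 - k ] (λ j → binom (d - j) (k - + 1) * binom (c + d - k) (j - + 1) * binom (P - c - d + + 2 * k - + 2) (P + k + j - d - + 1 - ℓ))
    in (ℓ : ℤ) → + 1 ≤ ℓ → ℓ ≤ c + d + + 1 - k →
       D ℓ ≡ Σ[ + 0 ⋯ k - + 1 ] (λ j → signℤ j * binom (d - + 1 - j) (k - + 1 - j) * binom (c + d - k) j * binom (P + k - + 2 - j) (ℓ + k - + 2 - c - j))
proposition5 p _ k c d 1≤k k≤c c≤d _ c+d≤p ℓ _ ℓ≤c+d+1-k with i≤j⇒∃[w]i+w≡j 1≤k
... | k' , refl with i≤j⇒∃[w]i+w≡j k≤c
... | u , refl with i≤j⇒∃[w]i+w≡j c≤d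
... | v , refl with i≤j⇒∃[w]i+w≡j c+d≤p
... | q , refl with i≤j⇒∃[w]i+w≡j ℓ≤c+d+1-k
... | w , ℓ+w≡c+d+1-k = Gaps.lhs≡rhs k' u v q ℓ w ℓ+w≡c+d+1-k
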